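{- Let $T\subseteq X_0$ be a generalised nice set such that both $T\setminus X$ and $T\cap X$ are non-empty. The following are equivalent: (i) $T\setminus X$ is not a generalised nice set; (ii) there exist distinct $i,j\in I$ with $\langle P_{\{i,j,i\}}\rangle\subseteq T$; (iii) there exist distinct $i,j\in I$ with $\{i,i\},\{0,j\}\in T$; (iv) $T\cap X$ is not a generalised nice set.
   Context: Let $I=\{1,\dots,7\}$ and $I_0=I\cup\{0\}$. The Fano plane on $I$ has the seven lines $\{1,2,5\},\{5,6,7\},\{1,4,7\},\{1,3,6\},\{2,4,6\},\{2,3,7\},\{3,4,5\}$. For distinct $i,j\in I$, $i*j$ is the third point of the unique line containing $i$ and $j$. The operation is extended to $I_0$ by $0*i=i*0=i$ and $i*i=0$ for all $i\in I_0$. Let $X_0$ be the set of unordered pairs $\{i,j\}$ with $i,j\in I_0$, where $i=j$ is allowed, and $X=\{\{i,j\}:i,j\in I,\ i\neq j\}$. For $i,j,k\in I_0$ let $P_{\{i,j,k\}}=\{\{i,j\},\{j,k\},\{k,i\},\{i,j*k\},\{j,k*i\},\{k,i*j\}\}\subseteq X_0$. A subset $T\subseteq X_0$ is a generalised nice set if for all $i,j,k\in I_0$, $\{i,j\}\in T$ and $\{i*j,k\}\in T$ imply $P_{\{i,j,k\}}\subseteq T$. For $S\subseteq X_0$, $\langle S\rangle$ denotes the smallest generalised nice set containing $S$. -}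

module Defs where

open import Data.Bool using (Bool; true; false; if_then_else_; _∧_; _∨_; not)
open import Data.Fin using (Fin; zero; suc; toℕ; #_)
open import Data.Fin.Properties using (_≟_)
open import Data.Nat using (_≤ᵇ_)
open import Data.List using (List; []; _∷_)
open import Data.Product using (_×_; _,_; ∃₂)
open import Relation.Nullary.Decidable using (⌊_⌋)
open import Relation.Binary.PropositionalEquality using (_≡_)

I₀ : Set
I₀ = Fin 8

InI : I₀ → Set
InI i = i Relation.Binary.PropositionalEquality.≢ zero

_==_ : I₀ → I₀ → Bool
a == b = ⌊ a ≟ b ⌋

-- The seven lines of the Fano plane on I.
fanoLines : List (I₀ × I₀ × I₀)
fanoLines =
  (# 1 , # 2 , # 5) ∷ (# 5 , # 6 , # 7) ∷ (# 1 , # 4 , # 7) ∷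
  (# 1 , # 3 , # 6) ∷ (# 2 , # 4 , # 6) ∷ (# 2 , # 3 , # 7) ∷
  (# 3 , # 4 , # 5) ∷ []

sameUPair : I₀ → I₀ → I₀ → I₀ → Bool
sameUPair a b c d = (a == c ∧ b == d) ∨ (a == d ∧ b == c)

third : I₀ → I₀ → List (I₀ × I₀ × I₀) → I₀
third i j [] = zero
third i j ((a , b , c) ∷ ls) =
  if sameUPair i j a b then c
  else if sameUPair i j b c then a
  else if sameUPair i j a c then b
  else third i j ls

_⋆_ : I₀ → I₀ → I₀
i ⋆ j = if i == j then zero
        else if i == zero then j
        else if j == zero then i
        else third i j fanoLines

-- Subsets of X₀ (unordered pairs {a,b}, a = b allowed).  A subset is
-- represented by a Boolean function; the pair {a,b} is looked up at
-- (min a b , max a b), so only entries with first ≤ second matter.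
Sub : Set
Sub = I₀ → I₀ → Bool

lo hi : I₀ → I₀ → I₀
lo a b = if toℕ a ≤ᵇ toℕ b then a else b
hi a b = if toℕ a ≤ᵇ toℕ b then b else a

[_,_]∈_ : I₀ → I₀ → Sub → Set
[ a , b ]∈ T = T (lo a b) (hi a b) ≡ true

_⊆_ : Sub → Sub → Set
S ⊆ T = ∀ a b → [ a , b ]∈ S → [ a , b ]∈ T

NonEmpty : Sub → Set
NonEmpty S = ∃₂ λ a b → [ a , b ]∈ S

inX : I₀ → I₀ → Bool
inX a b = not (a == zero) ∧ not (b == zero) ∧ not (a == b)

_∖X : Sub → Sub
(T ∖X) a b = T a b ∧ not (inX a b)

_∩X : Sub → Sub
(T ∩X) a b = T a b ∧ inX a b

P : I₀ → I₀ → I₀ → Sub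
P i j k a b =
  sameUPair a b i j ∨ sameUPair a b j k ∨ sameUPair a b k i ∨
  sameUPair a b i (j ⋆ k) ∨ sameUPair a b j (k ⋆ i) ∨ sameUPair a b k (i ⋆ j)

Nice : Sub → Set
Nice T = ∀ i j k → [ i , j ]∈ T → [ i ⋆ j , k ]∈ T → P i j k ⊆ T

[_,_]∈⟨_⟩ : I₀ → I₀ → Sub → Set
[ a , b ]∈⟨ S ⟩ = ∀ (U : Sub) → Nice U → S ⊆ U → [ a , b ]∈ U

⟨_⟩⊆_ : Sub → Sub → Set
⟨ S ⟩⊆ T = ∀ a b → [ a , b ]∈⟨ S ⟩ → [ a , b ]∈ T

{-# OPTIONS --safe #-}
-- Outside X lie only the pairs {0,a} and {a,a}.  If T contains {i,i} and
-- {0,j} = {i*i,j} with i ≠ j in I (condition (iii)), the nice rule gives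
-- P_{i,i,j} = P_{i,j,i} ⊆ T, which contains both {i,j} ∈ X and {i,i} ∉ X, so neither
-- T ∖ X nor T ∩ X is nice; and (iii) is also exactly what ⟨P_{i,j,i}⟩ ⊆ T amounts to.
-- Conversely, by inspection of the Fano plane, an instance of the rule with both
-- premises outside X (resp. inside X) has P_{i,j,k} outside X (resp. inside X),
-- except when the premises are {i,i}, {0,k} (resp. when k ∈ {i,j}, and then
-- P_{i,j,k} ⊆ T contains {k,k} and {0,·}).  So without (iii) both halves of T are
-- nice, and since (iii) is decidable this gives the remaining implications.
module Submission where

open import Defs
open import Data.Fin using (zero)
open import Data.Product using (_×_; ∃₂)
open import Function.Bundles using (_⇔_)
open import Relation.Nullary using (¬_)
open import Relation.Binary.PropositionalEquality using (_≢_)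

open import Data.Bool using (true; false; _∧_; _∨_; not)
open import Data.Bool.Properties using (T-≡; T-∨; ∧-conicalˡ; ∧-conicalʳ; not-injective; not-¬)
  renaming (_≟_ to _≟ᵇ_)
open import Data.Empty using (⊥-elim)
open import Data.Fin using (toℕ)
open import Data.Fin.Properties using (all?; any?) renaming (_≟_ to _≟ᶠ_)
open import Data.Nat using (_≤ᵇ_)
open import Data.Product using (_,_)
open import Data.Sum using (_⊎_; inj₁; inj₂; [_,_]′)
import Data.Sum as Sum
open import Function using (id; _∘_)
open import Function.Bundles using (mk⇔; Equivalence)
open import Level using (0ℓ)
open import Relation.Binary using (Rel)
open import Relation.Binary.PropositionalEquality using (_≡_; refl; sym; trans; subst; cong; cong₂)
open import Relation.Nullary using (Dec)
open import Relation.Nullary.Decidable using (from-yes; decidable-stable; _×-dec_; _⊎-dec_; _→-dec_; ¬?)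

InX NotInX : Rel I₀ 0ℓ
InX a b = inX a b ≡ true
NotInX a b = inX a b ≡ false

AllPairs : Rel I₀ 0ℓ → I₀ → I₀ → I₀ → Set
AllPairs Q i j k = Q i j × Q j k × Q k i × Q i (j ⋆ k) × Q j (k ⋆ i) × Q k (i ⋆ j)

SamePair : I₀ → I₀ → I₀ → I₀ → Set
SamePair a b c d = (a ≡ c × b ≡ d) ⊎ (a ≡ d × b ≡ c)

[_,_]∈?_ : ∀ a b T → Dec ([ a , b ]∈ T)
[ a , b ]∈? T = T (lo a b) (hi a b) ≟ᵇ true

allPairs? : ∀ {Q} → (∀ a b → Dec (Q a b)) → ∀ i j k → Dec (AllPairs Q i j k)
allPairs? Q? i j k = Q? i j ×-dec Q? j k ×-dec Q? k i ×-dec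
  Q? i (j ⋆ k) ×-dec Q? j (k ⋆ i) ×-dec Q? k (i ⋆ j)

⋆-self : ∀ i → i ⋆ i ≡ zero
⋆-self = from-yes (all? λ i → i ⋆ i ≟ᶠ zero)

lo-comm : ∀ a b → lo a b ≡ lo b a
lo-comm = from-yes (all? λ a → all? λ b → lo a b ≟ᶠ lo b a)

hi-comm : ∀ a b → hi a b ≡ hi b a
hi-comm = from-yes (all? λ a → all? λ b → hi a b ≟ᶠ hi b a)

sameUPair-sound : ∀ a b c d → sameUPair a b c d ≡ true → SamePair a b c d
sameUPair-sound = from-yes (all? λ a → all? λ b → all? λ c → all? λ d →
  (sameUPair a b c d ≟ᵇ true) →-dec ((a ≟ᶠ c ×-dec b ≟ᶠ d) ⊎-dec (a ≟ᶠ d ×-dec b ≟ᶠ c)))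

inX-comm : ∀ a b → inX a b ≡ inX b a
inX-comm = from-yes (all? λ a → all? λ b → inX a b ≟ᵇ inX b a)

inX-lo-hi : ∀ a b → inX (lo a b) (hi a b) ≡ inX a b
inX-lo-hi = from-yes (all? λ a → all? λ b → inX (lo a b) (hi a b) ≟ᵇ inX a b)

inX-diag : ∀ i → NotInX i i
inX-diag = from-yes (all? λ i → inX i i ≟ᵇ false)

inX-sound : ∀ i j → InX i j → InI i × InI j × i ≢ j
inX-sound = from-yes (all? λ i → all? λ j → (inX i j ≟ᵇ true) →-dec
  (¬? (i ≟ᶠ zero) ×-dec ¬? (j ≟ᶠ zero) ×-dec ¬? (i ≟ᶠ j)))

inX-complete : ∀ i j → InI i → InI j → i ≢ j → InX i j
inX-complete = from-yes (all? λ i → all? λ j →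
  ¬? (i ≟ᶠ zero) →-dec ¬? (j ≟ᶠ zero) →-dec ¬? (i ≟ᶠ j) →-dec (inX i j ≟ᵇ true))

inX-⋆ : ∀ i j → InX i j → InX (i ⋆ j) i
inX-⋆ = from-yes (all? λ i → all? λ j → (inX i j ≟ᵇ true) →-dec (inX (i ⋆ j) i ≟ᵇ true))

P-generators : ∀ i j k → AllPairs (λ a b → [ a , b ]∈ P i j k) i j k
P-generators = from-yes (all? λ i → all? λ j → all? λ k →
  allPairs? (λ a b → [ a , b ]∈? P i j k) i j k)

P-avoids-X : ∀ i j k → NotInX i j → NotInX (i ⋆ j) k →
             AllPairs NotInX i j k ⊎ (j ≡ i × InI i × InI k × i ≢ k)
P-avoids-X = from-yes (all? λ i → all? λ j → all? λ k →
  (inX i j ≟ᵇ false) →-dec (inX (i ⋆ j) k ≟ᵇ false) →-dec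
  (allPairs? (λ a b → inX a b ≟ᵇ false) i j k ⊎-dec
   (j ≟ᶠ i ×-dec ¬? (i ≟ᶠ zero) ×-dec ¬? (k ≟ᶠ zero) ×-dec ¬? (i ≟ᶠ k))))

P-inside-X : ∀ i j k → InX i j → InX (i ⋆ j) k → AllPairs InX i j k ⊎ (k ≡ i ⊎ k ≡ j)
P-inside-X = from-yes (all? λ i → all? λ j → all? λ k →
  (inX i j ≟ᵇ true) →-dec (inX (i ⋆ j) k ≟ᵇ true) →-dec
  (allPairs? (λ a b → inX a b ≟ᵇ true) i j k ⊎-dec (k ≟ᶠ i ⊎-dec k ≟ᶠ j)))

SamePair-lo-hi : ∀ a b → SamePair a b (lo a b) (hi a b)
SamePair-lo-hi a b with toℕ a ≤ᵇ toℕ b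
... | true  = inj₁ (refl , refl)
... | false = inj₂ (refl , refl)

SamePair-resp : ∀ {Q : Rel I₀ 0ℓ} {a b c d} → (∀ a b → Q a b → Q b a) → SamePair a b c d → Q c d → Q a b
SamePair-resp _    (inj₁ (refl , refl)) = id
SamePair-resp symQ (inj₂ (refl , refl)) = symQ _ _

∨-true⁻ : ∀ {x y} → x ∨ y ≡ true → x ≡ true ⊎ y ≡ true
∨-true⁻ = Sum.map (Equivalence.to T-≡) (Equivalence.to T-≡) ∘ Equivalence.to T-∨ ∘ Equivalence.from T-≡

AllPairs⇒P⊆ : ∀ {Q : Rel I₀ 0ℓ} i j k → (∀ a b → Q a b → Q b a) → AllPairs Q i j k →
              ∀ a b → [ a , b ]∈ P i j k → Q a b
AllPairs⇒P⊆ {Q} i j k symQ (qij , qjk , qki , qi , qj , qk) a b ab∈P =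
  [ from qij , [ from qjk , [ from qki , [ from qi , [ from qj , from qk ]′ ∘ ∨-true⁻ ]′
    ∘ ∨-true⁻ ]′ ∘ ∨-true⁻ ]′ ∘ ∨-true⁻ ]′ (∨-true⁻ ab∈P)
  where
  from : ∀ {c d} → Q c d → sameUPair (lo a b) (hi a b) c d ≡ true → Q a b
  from {c} {d} q eq =
    SamePair-resp symQ (SamePair-lo-hi a b)
      (SamePair-resp symQ (sameUPair-sound (lo a b) (hi a b) c d eq) q)

∈-sym : ∀ T a b → [ a , b ]∈ T → [ b , a ]∈ T
∈-sym T a b rewrite lo-comm a b | hi-comm a b = id

InX-sym : ∀ a b → InX a b → InX b a
InX-sym a b = trans (inX-comm b a)

NotInX-sym : ∀ a b → NotInX a b → NotInX b a
NotInX-sym a b = trans (inX-comm b a)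

∈∖X⁺ : ∀ T a b → [ a , b ]∈ T → NotInX a b → [ a , b ]∈ (T ∖X)
∈∖X⁺ T a b ab∈T ab∉X = cong₂ _∧_ ab∈T (cong not (trans (inX-lo-hi a b) ab∉X))

∈∖X⁻ : ∀ T a b → [ a , b ]∈ (T ∖X) → [ a , b ]∈ T × NotInX a b
∈∖X⁻ T a b ab∈ =
  ∧-conicalˡ _ _ ab∈ ,
  trans (sym (inX-lo-hi a b)) (not-injective (∧-conicalʳ (T (lo a b) (hi a b)) _ ab∈))

∈∩X⁺ : ∀ T a b → [ a , b ]∈ T → InX a b → [ a , b ]∈ (T ∩X)
∈∩X⁺ T a b ab∈T ab∈X = cong₂ _∧_ ab∈T (trans (inX-lo-hi a b) ab∈X)

∈∩X⁻ : ∀ T a b → [ a , b ]∈ (T ∩X) → [ a , b ]∈ T × InX a b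
∈∩X⁻ T a b ab∈ =
  ∧-conicalˡ _ _ ab∈ , trans (sym (inX-lo-hi a b)) (∧-conicalʳ (T (lo a b) (hi a b)) _ ab∈)

P-rotate : ∀ i j k → P i j k ⊆ P k i j
P-rotate i j k =
  let ki , ij , jk , k-ij , i-jk , j-ki = P-generators k i j
  in  AllPairs⇒P⊆ i j k (∈-sym (P k i j)) (ij , jk , ki , i-jk , j-ki , k-ij)

⟨⟩-extensive : ∀ S a b → [ a , b ]∈ S → [ a , b ]∈⟨ S ⟩
⟨⟩-extensive S a b ab∈S U _ S⊆U = S⊆U a b ab∈S

⟨⟩-least : ∀ S T → Nice T → S ⊆ T → ⟨ S ⟩⊆ T
⟨⟩-least S T nice S⊆T a b ab∈⟨S⟩ = ab∈⟨S⟩ T nice S⊆T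

Obstruction : Sub → Set
Obstruction T = ∃₂ λ i j → InI i × InI j × i ≢ j × [ i , i ]∈ T × [ zero , j ]∈ T

obstruction? : ∀ T → Dec (Obstruction T)
obstruction? T = any? λ i → any? λ j →
  ¬? (i ≟ᶠ zero) ×-dec ¬? (j ≟ᶠ zero) ×-dec ¬? (i ≟ᶠ j) ×-dec
  [ i , i ]∈? T ×-dec [ zero , j ]∈? T

obstruction : ∀ T i j → InI i → InI j → i ≢ j → [ i , i ]∈ T → [ j , i ⋆ i ]∈ T → Obstruction T
obstruction T i j i∈I j∈I i≢j ii∈T j-ii∈T =
  i , j , i∈I , j∈I , i≢j , ii∈T , ∈-sym T j zero (subst (λ z → [ j , z ]∈ T) (⋆-self i) j-ii∈T)

obstruction-of-P⊆ : ∀ T i j k → InX i j → P i j k ⊆ T → k ≡ i ⊎ k ≡ j → Obstruction T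
obstruction-of-P⊆ T i j k ij∈X P⊆T k∈ij with inX-sound i j ij∈X | k∈ij
... | i∈I , j∈I , i≢j | inj₁ refl =
  let _ , _ , ii , _ , j-ii , _ = P-generators i j i
  in  obstruction T i j i∈I j∈I i≢j (P⊆T i i ii) (P⊆T j (i ⋆ i) j-ii)
... | i∈I , j∈I , i≢j | inj₂ refl =
  let _ , jj , _ , i-jj , _ , _ = P-generators i j j
  in  obstruction T j i j∈I i∈I (i≢j ∘ sym) (P⊆T j j jj) (P⊆T i (j ⋆ j) i-jj)

P⊆-of-obstruction : ∀ T i j → Nice T → [ i , i ]∈ T → [ zero , j ]∈ T → P i j i ⊆ T
P⊆-of-obstruction T i j nice ii∈T 0j∈T a b =
  nice i i j ii∈T (subst (λ z → [ z , j ]∈ T) (sym (⋆-self i)) 0j∈T) a b ∘ P-rotate i j i a b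

∖X-nice : ∀ T → Nice T → ¬ Obstruction T → Nice (T ∖X)
∖X-nice T nice ¬obs i j k ij∈ ij-k∈ a b ab∈P =
  let ij∈T   , ij∉X   = ∈∖X⁻ T i j ij∈
      ij-k∈T , ij-k∉X = ∈∖X⁻ T (i ⋆ j) k ij-k∈
  in  [ (λ P∉X → ∈∖X⁺ T a b (nice i j k ij∈T ij-k∈T a b ab∈P) (AllPairs⇒P⊆ i j k NotInX-sym P∉X a b ab∈P))
      , (λ { (refl , i∈I , k∈I , i≢k) →
               ⊥-elim (¬obs (obstruction T i k i∈I k∈I i≢k ij∈T (∈-sym T (i ⋆ i) k ij-k∈T))) })
      ]′ (P-avoids-X i j k ij∉X ij-k∉X)

∩X-nice : ∀ T → Nice T → ¬ Obstruction T → Nice (T ∩X)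
∩X-nice T nice ¬obs i j k ij∈ ij-k∈ a b ab∈P =
  let ij∈T   , ij∈X   = ∈∩X⁻ T i j ij∈
      ij-k∈T , ij-k∈X = ∈∩X⁻ T (i ⋆ j) k ij-k∈
      P⊆T = nice i j k ij∈T ij-k∈T
  in  [ (λ P∈X → ∈∩X⁺ T a b (P⊆T a b ab∈P) (AllPairs⇒P⊆ i j k InX-sym P∈X a b ab∈P))
      , (λ k∈ij → ⊥-elim (¬obs (obstruction-of-P⊆ T i j k ij∈X P⊆T k∈ij)))
      ]′ (P-inside-X i j k ij∈X ij-k∈X)

obstruction⇒¬nice∖X : ∀ T → Obstruction T → ¬ Nice (T ∖X)
obstruction⇒¬nice∖X T (i , j , i∈I , j∈I , i≢j , ii∈T , 0j∈T) nice =
  let ii∈   = ∈∖X⁺ T i i ii∈T (inX-diag i)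
      ii-j∈ = subst (λ z → [ z , j ]∈ (T ∖X)) (sym (⋆-self i)) (∈∖X⁺ T zero j 0j∈T refl)
      _ , ij∈P , _ = P-generators i i j
      _ , ij∉X = ∈∖X⁻ T i j (nice i i j ii∈ ii-j∈ i j ij∈P)
  in  not-¬ ij∉X (inX-complete i j i∈I j∈I i≢j)

obstruction⇒¬nice∩X : ∀ T → Nice T → Obstruction T → ¬ Nice (T ∩X)
obstruction⇒¬nice∩X T nice (i , j , i∈I , j∈I , i≢j , ii∈T , 0j∈T) nice∩X =
  let P⊆T = P⊆-of-obstruction T i j nice ii∈T 0j∈T
      ij∈P , _ , ii∈P , _ , _ , i-ij∈P = P-generators i j i
      ij∈X  = inX-complete i j i∈I j∈I i≢j
      ij∈   = ∈∩X⁺ T i j (P⊆T i j ij∈P) ij∈X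
      ij-i∈ = ∈∩X⁺ T (i ⋆ j) i (∈-sym T i (i ⋆ j) (P⊆T i (i ⋆ j) i-ij∈P)) (inX-⋆ i j ij∈X)
      _ , ii∈X = ∈∩X⁻ T i i (nice∩X i j i ij∈ ij-i∈ i i ii∈P)
  in  not-¬ (inX-diag i) ii∈X

Contains⟨P⟩ : Sub → Set
Contains⟨P⟩ T = ∃₂ λ i j → InI i × InI j × i ≢ j × ⟨ P i j i ⟩⊆ T

obstruction⇒contains⟨P⟩ : ∀ T → Nice T → Obstruction T → Contains⟨P⟩ T
obstruction⇒contains⟨P⟩ T nice (i , j , i∈I , j∈I , i≢j , ii∈T , 0j∈T) =
  i , j , i∈I , j∈I , i≢j , ⟨⟩-least (P i j i) T nice (P⊆-of-obstruction T i j nice ii∈T 0j∈T)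

contains⟨P⟩⇒obstruction : ∀ T → Contains⟨P⟩ T → Obstruction T
contains⟨P⟩⇒obstruction T (i , j , i∈I , j∈I , i≢j , ⟨P⟩⊆T) =
  obstruction-of-P⊆ T i j i (inX-complete i j i∈I j∈I i≢j)
    (λ a b → ⟨P⟩⊆T a b ∘ ⟨⟩-extensive (P i j i) a b) (inj₁ refl)

proposition2p8 : (T : Sub) → Nice T → NonEmpty (T ∖X) → NonEmpty (T ∩X) →
      ((¬ Nice (T ∖X)) ⇔ (∃₂ λ i j → InI i × InI j × i ≢ j × ⟨ P i j i ⟩⊆ T))
    × ((∃₂ λ i j → InI i × InI j × i ≢ j × ⟨ P i j i ⟩⊆ T)
        ⇔ (∃₂ λ i j → InI i × InI j × i ≢ j × [ i , i ]∈ T × [ zero , j ]∈ T))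
    × ((∃₂ λ i j → InI i × InI j × i ≢ j × [ i , i ]∈ T × [ zero , j ]∈ T)
        ⇔ (¬ Nice (T ∩X)))
proposition2p8 T nice _ _ =
  mk⇔ (obstruction⇒contains⟨P⟩ T nice ∘ obstruction-if-¬nice (T ∖X) (∖X-nice T nice))
      (obstruction⇒¬nice∖X T ∘ contains⟨P⟩⇒obstruction T) ,
  mk⇔ (contains⟨P⟩⇒obstruction T) (obstruction⇒contains⟨P⟩ T nice) ,
  mk⇔ (obstruction⇒¬nice∩X T nice) (obstruction-if-¬nice (T ∩X) (∩X-nice T nice))
  where
  obstruction-if-¬nice : ∀ U → (¬ Obstruction T → Nice U) → ¬ Nice U → Obstruction T
  obstruction-if-¬nice _ nice-if-¬obs ¬nice =
    decidable-stable (obstruction? T) (¬nice ∘ nice-if-¬obs)
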